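{- If $H$ is a multi-topological minor of a graph $G$, then $\mathrm{sn}(H)\leq \mathrm{sn}(G)$.
   Context: Graphs are finite, with multiple edges allowed but no loops. If $u$ is a vertex adjacent to exactly two other vertices, $v$ via $m$ parallel edges and $w$ via $n$ parallel edges, a multi-smoothing at $u$ deletes $u$ (and its incident edges) and adds $\min\{m,n\}$ edges between $v$ and $w$. $H$ is a multi-topological minor of $G$ if $H$ can be obtained from $G$ by deleting vertices, deleting edges, and performing multi-smoothings. An egg is a nonempty vertex subset inducing a connected subgraph; a scramble $\mathcal{S}$ is a collection of eggs; $h(\mathcal{S})$ is the minimum size of a vertex set meeting every egg; an egg-cut is an edge set whose deletion disconnects the graph into two components each containing an egg, and $e(\mathcal{S})$ is the minimum size of an egg-cut ($\infty$ if none); $\|\mathcal{S}\|=\min\{h(\mathcal{S}),e(\mathcal{S})\}$; $\mathrm{sn}(G)$ is the maximum order of a scramble on $G$. -}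

module Defs where

open import Data.Nat using (ℕ; zero; suc; _+_; _≤_; _<_; _⊔_; _⊓_; _<ᵇ_)
open import Data.Fin using (Fin; toℕ; punchIn; _≟_)
open import Data.Fin.Subset using (Subset; _∈_; ∣_∣)
open import Data.Fin.Permutation using (Permutation′; _⟨$⟩ʳ_)
open import Data.List using (List; map; allFin)
open import Data.Nat.ListAction using (sum)
open import Data.List.Membership.Propositional renaming (_∈_ to _∈ₗ_)
open import Data.Product using (Σ; ∃; ∃-syntax; _×_; _,_)
open import Data.Bool using (if_then_else_; _∨_; _∧_)
open import Relation.Nullary using (¬_; does)
open import Relation.Binary.PropositionalEquality using (_≡_; _≢_)

-- A finite loopless multigraph on the vertex set Fin n:
-- adj u v is the number of parallel edges between u and v.
record Graph (n : ℕ) : Set where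
  field
    adj      : Fin n → Fin n → ℕ
    adj-sym  : ∀ u v → adj u v ≡ adj v u
    loopless : ∀ u → adj u u ≡ 0
open Graph public

data Reach {n : ℕ} (A : Fin n → Fin n → ℕ) (P : Subset n) : Fin n → Fin n → Set where
  here : ∀ {u} → u ∈ P → Reach A P u u
  step : ∀ {u w v} → u ∈ P → 0 < A u w → Reach A P w v → Reach A P u v

full : ∀ {n} → Subset n
full {n} = Data.Fin.Subset.⊤
  where import Data.Fin.Subset

IsEgg : ∀ {n} → Graph n → Subset n → Set
IsEgg G E = (∃[ u ] u ∈ E) × (∀ u v → u ∈ E → v ∈ E → Reach (adj G) E u v)

record Scramble {n : ℕ} (G : Graph n) : Set where
  field
    eggs   : List (Subset n)
    areEggs : ∀ E → E ∈ₗ eggs → IsEgg G E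
open Scramble public

Hits : ∀ {n} {G : Graph n} → Scramble G → Subset n → Set
Hits S T = ∀ E → E ∈ₗ eggs S → ∃[ v ] (v ∈ T × v ∈ E)

ΣFin : ∀ {n} → (Fin n → ℕ) → ℕ
ΣFin {n} f = sum (map f (allFin n))

record EdgeSet {n : ℕ} (G : Graph n) : Set where
  field
    cnt     : Fin n → Fin n → ℕ
    cnt-sym : ∀ u v → cnt u v ≡ cnt v u
    cnt-≤   : ∀ u v → cnt u v ≤ adj G u v
open EdgeSet public

edgeCount : ∀ {n} {G : Graph n} → EdgeSet G → ℕ
edgeCount C = ΣFin (λ u → ΣFin (λ v → if toℕ u <ᵇ toℕ v then cnt C u v else 0))

deleteEdges : ∀ {n} (G : Graph n) → EdgeSet G → Fin n → Fin n → ℕ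
deleteEdges G C u v = adj G u v Data.Nat.∸ cnt C u v
  where import Data.Nat

IsEggCut : ∀ {n} {G : Graph n} → Scramble G → EdgeSet G → Set
IsEggCut {G = G} S C =
  Σ _ λ E₁ → Σ _ λ E₂ → E₁ ∈ₗ eggs S × E₂ ∈ₗ eggs S ×
    (∀ u v → u ∈ E₁ → v ∈ E₁ → Reach (deleteEdges G C) full u v) ×
    (∀ u v → u ∈ E₂ → v ∈ E₂ → Reach (deleteEdges G C) full u v) ×
    (∀ u v → u ∈ E₁ → v ∈ E₂ → ¬ Reach (deleteEdges G C) full u v)

HittingNumberAtLeast : ∀ {n} {G : Graph n} → Scramble G → ℕ → Set
HittingNumberAtLeast S k = ∀ T → Hits S T → k ≤ ∣ T ∣

-- e(S) ≥ k  (vacuous when there is no egg-cut, e(S) = ∞)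
EggCutNumberAtLeast : ∀ {n} {G : Graph n} → Scramble G → ℕ → Set
EggCutNumberAtLeast S k = ∀ C → IsEggCut S C → k ≤ edgeCount C

OrderAtLeast : ∀ {n} {G : Graph n} → Scramble G → ℕ → Set
OrderAtLeast S k = HittingNumberAtLeast S k × EggCutNumberAtLeast S k

SnAtLeast : ∀ {n} → Graph n → ℕ → Set
SnAtLeast G k = Σ (Scramble G) λ S → OrderAtLeast S k

-- sn(H) ≤ sn(G)  (sn is a maximum, so this is ∀ k, sn(H) ≥ k → sn(G) ≥ k)
_sn≤_ : ∀ {m n} → Graph m → Graph n → Set
H sn≤ G = ∀ k → SnAtLeast H k → SnAtLeast G k

data _≼_ : ∀ {m n} → Graph m → Graph n → Set where
  iso : ∀ {n} {H G : Graph n} (σ : Permutation′ n) →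
        (∀ i j → adj H i j ≡ adj G (σ ⟨$⟩ʳ i) (σ ⟨$⟩ʳ j)) → H ≼ G
  delE : ∀ {n} {H G : Graph n} → (∀ i j → adj H i j ≤ adj G i j) → H ≼ G
  delV : ∀ {n} {H : Graph n} {G : Graph (suc n)} (x : Fin (suc n)) →
         (∀ i j → adj H i j ≡ adj G (punchIn x i) (punchIn x j)) → H ≼ G
  -- multi-smoothing at x, whose only neighbours are v ≠ w (indices in G - x)
  smooth : ∀ {n} {H : Graph n} {G : Graph (suc n)} (x : Fin (suc n)) (v w : Fin n) →
           v ≢ w →
           0 < adj G x (punchIn x v) →
           0 < adj G x (punchIn x w) →
           (∀ y → y ≢ v → y ≢ w → adj G x (punchIn x y) ≡ 0) →
           (∀ i j → adj H i j ≡
              adj G (punchIn x i) (punchIn x j) +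
              (if ((does (i ≟ v) ∧ does (j ≟ w)) ∨ (does (i ≟ w) ∧ does (j ≟ v)))
               then (adj G x (punchIn x v) ⊓ adj G x (punchIn x w))
               else 0)) →
           H ≼ G
  trans≼ : ∀ {l m n} {K : Graph l} {H : Graph m} {G : Graph n} → K ≼ H → H ≼ G → K ≼ G

-- A scramble on H is carried to G along a vertex map: every egg goes to its image (for a
-- smoothing at x, together with x when the egg contains v, to which x is adjacent), and a
-- vertex set meeting all image eggs pulls back to one of at most the same size meeting all
-- original eggs. Egg-cuts are handled through 2-colourings: the vertices reachable from one
-- egg after deleting an egg-cut C form a colouring whose boundary lies inside C and separates
-- two eggs, and every such boundary is itself an egg-cut. Pulling this colouring back to H
-- gives an egg-cut of H no larger than C; for a smoothing, the new v–w edges that cross are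
-- paid for by the edges from x to whichever of v, w is coloured differently from x.

module Submission where

open import Defs
open import Data.Nat using (ℕ; zero; suc; _+_; _*_; _∸_; _≤_; _<_; _⊔_; _<ᵇ_; z≤n; s≤s; _<?_)
open import Data.Nat.Properties hiding (_≟_; 0≢1+n; suc-injective)
open import Data.Nat.ListAction using () renaming (sum to listSum)
open import Data.Bool using (Bool; true; false; T; if_then_else_; _∧_; _∨_; _xor_)
open import Data.Bool.Properties using (xor-same; xor-comm)
open import Data.Fin using (Fin; zero; suc; toℕ; punchIn; punchOut; _≟_)
open import Data.Fin.Properties using (any?; punchIn-injective; punchInᵢ≢i; punchIn-punchOut; punchOut-injective; toℕ-injective; suc-injective; 0≢1+n)
open import Data.Fin.Subset using (Subset; _∈_; _⊆_; ∣_∣; _∪_; _-_; ⁅_⁆) renaming (⊥ to ∅)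
open import Data.Fin.Subset.Properties using (_∈?_; ∈⊤; x∈⁅x⁆; x∈⁅y⁆⇒x≡y; ∉⊥; ∣⊥∣≡0; ∣⁅x⁆∣≡1; x∈p∪q⁺; x∈p∪q⁻; x∈p∧x≢y⇒x∈p-y; p─q⊆p; x∈p⇒∣p-x∣<∣p∣)
open import Data.Fin.Permutation using (Permutation′; _⟨$⟩ʳ_; _⟨$⟩ˡ_; inverseˡ)
open import Data.Vec using ([]; _∷_; there; lookup; tabulate)
open import Data.Vec.Properties using ([]=⇒lookup; lookup⇒[]=; lookup∘tabulate)
import Data.List as List
open import Data.List.Properties using (map-tabulate)
open import Data.List.Membership.Propositional using () renaming (_∈_ to _∈ₗ_)
open import Data.List.Membership.Propositional.Properties using (∈-map⁺; ∈-map⁻)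
open import Data.Product using (Σ; ∃-syntax; _×_; _,_; proj₁; proj₂)
open import Data.Sum using (_⊎_; inj₁; inj₂)
open import Data.Empty using (⊥-elim)
open import Function using (_∘_; id)
open import Function.Definitions using (Injective)
open import Relation.Nullary using (¬_; Dec; yes; no; does; contradiction)
open import Relation.Nullary.Decidable using (_×-dec_; dec-true; dec-false; map′)
open import Relation.Nullary.Reflects using (ofʸ; ofⁿ)
open import Relation.Binary.PropositionalEquality
open import Algebra.Properties.CommutativeMonoid.Sum +-0-commutativeMonoid using (sum; sum-cong-≗; sum-remove; sum-replicate-zero; ∑-distrib-+; ∑-comm)

sum-tabulate : ∀ {n} (f : Fin n → ℕ) → listSum (List.tabulate f) ≡ sum f
sum-tabulate {zero} f = refl
sum-tabulate {suc n} f = cong (f zero +_) (sum-tabulate (f ∘ suc))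

ΣFin≡sum : ∀ {n} (f : Fin n → ℕ) → ΣFin f ≡ sum f
ΣFin≡sum f = trans (cong listSum (map-tabulate id f)) (sum-tabulate f)

sum-mono-≤ : ∀ {n} {f g : Fin n → ℕ} → (∀ i → f i ≤ g i) → sum f ≤ sum g
sum-mono-≤ {zero} _ = z≤n
sum-mono-≤ {suc n} f≤g = +-mono-≤ (f≤g zero) (sum-mono-≤ (f≤g ∘ suc))

term≤sum : ∀ {n} (f : Fin n → ℕ) (i : Fin n) → f i ≤ sum f
term≤sum {suc n} f i = subst (f i ≤_) (sym (sum-remove {i = i} f)) (m≤m+n (f i) _)

sum-select : ∀ {n} (a : Fin n) (f : Fin n → ℕ) → sum (λ i → if does (i ≟ a) then f i else 0) ≡ f a
sum-select {suc n} a f = begin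
  sum g                      ≡⟨ sum-remove {i = a} g ⟩
  g a + sum (g ∘ punchIn a)  ≡⟨ cong₂ _+_ g-at-a (trans (sum-cong-≗ g-off-a) (sum-replicate-zero n)) ⟩
  f a + 0                    ≡⟨ +-identityʳ (f a) ⟩
  f a                        ∎
  where
  open ≡-Reasoning
  g : Fin (suc n) → ℕ
  g i = if does (i ≟ a) then f i else 0
  g-at-a : g a ≡ f a
  g-at-a rewrite dec-true (a ≟ a) refl = refl
  g-off-a : ∀ j → g (punchIn a j) ≡ 0
  g-off-a j rewrite dec-false (punchIn a j ≟ a) (punchInᵢ≢i a j) = refl

sum∘injective≤sum : ∀ {m n} (f : Fin n → ℕ) (φ : Fin m → Fin n) → Injective _≡_ _≡_ φ → sum (f ∘ φ) ≤ sum f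
sum∘injective≤sum {zero} f φ _ = z≤n
sum∘injective≤sum {suc m} {zero} f φ _ with φ zero
... | ()
sum∘injective≤sum {suc m} {suc n} f φ φ-inj = begin
  f φ₀ + sum (f ∘ φ ∘ suc)             ≡⟨ cong (f φ₀ +_) (sum-cong-≗ (λ j → cong f (sym (punchIn-punchOut (φ₀≢ j))))) ⟩
  f φ₀ + sum (f ∘ punchIn φ₀ ∘ ψ)      ≤⟨ +-monoʳ-≤ (f φ₀) (sum∘injective≤sum (f ∘ punchIn φ₀) ψ ψ-inj) ⟩
  f φ₀ + sum (f ∘ punchIn φ₀)          ≡⟨ sym (sum-remove {i = φ₀} f) ⟩
  sum f                                ∎
  where
  open ≤-Reasoning
  φ₀ = φ zero
  φ₀≢ : ∀ j → φ₀ ≢ φ (suc j)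
  φ₀≢ j = 0≢1+n ∘ φ-inj
  -- φ on the remaining indices, with the gap at φ₀ closed up
  ψ : Fin m → Fin n
  ψ j = punchOut (φ₀≢ j)
  ψ-inj : Injective _≡_ _≡_ ψ
  ψ-inj e = suc-injective (φ-inj (punchOut-injective (φ₀≢ _) (φ₀≢ _) e))

pairSum : ∀ {n} → (Fin n → Fin n → ℕ) → ℕ
pairSum f = sum (λ u → sum (f u))

pairSum-mono-≤ : ∀ {n} {f g : Fin n → Fin n → ℕ} → (∀ u v → f u v ≤ g u v) → pairSum f ≤ pairSum g
pairSum-mono-≤ f≤g = sum-mono-≤ (λ u → sum-mono-≤ (f≤g u))

pairSum-+ : ∀ {n} (f g : Fin n → Fin n → ℕ) → pairSum (λ u v → f u v + g u v) ≡ pairSum f + pairSum g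
pairSum-+ f g = trans (sum-cong-≗ (λ u → ∑-distrib-+ (f u) (g u))) (∑-distrib-+ (λ u → sum (f u)) (λ u → sum (g u)))

pairSum-transpose : ∀ {n} (f : Fin n → Fin n → ℕ) → pairSum (λ u v → f v u) ≡ pairSum f
pairSum-transpose f = ∑-comm (λ u v → f v u)

pairSum∘injective≤pairSum : ∀ {m n} (f : Fin n → Fin n → ℕ) (φ : Fin m → Fin n) → Injective _≡_ _≡_ φ →
  pairSum (λ i j → f (φ i) (φ j)) ≤ pairSum f
pairSum∘injective≤pairSum f φ φ-inj =
  ≤-trans (sum-mono-≤ (λ i → sum∘injective≤sum (f (φ i)) φ φ-inj)) (sum∘injective≤sum (λ u → sum (f u)) φ φ-inj)

pairSum-remove : ∀ {n} (x : Fin (suc n)) (f : Fin (suc n) → Fin (suc n) → ℕ) →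
  pairSum f ≡ sum (f x) + (sum (λ i → f (punchIn x i) x) + pairSum (λ i j → f (punchIn x i) (punchIn x j)))
pairSum-remove x f =
  trans (sum-remove {i = x} (λ u → sum (f u)))
        (cong (sum (f x) +_) (trans (sum-cong-≗ (λ i → sum-remove {i = x} (f (punchIn x i))))
                                    (∑-distrib-+ (λ i → f (punchIn x i) x) _)))

pairSum-select : ∀ {n} (a b : Fin n) (f : Fin n → Fin n → ℕ) →
  pairSum (λ i j → if does (i ≟ a) ∧ does (j ≟ b) then f i j else 0) ≡ f a b
pairSum-select {n} a b f = begin
  pairSum (λ i j → if does (i ≟ a) ∧ does (j ≟ b) then f i j else 0)  ≡⟨ sum-cong-≗ (λ i → row (does (i ≟ a)) i) ⟩
  sum (λ i → if does (i ≟ a) then f i b else 0)                        ≡⟨ sum-select a (λ i → f i b) ⟩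
  f a b                                                                ∎
  where
  open ≡-Reasoning
  row : ∀ c i → sum (λ j → if c ∧ does (j ≟ b) then f i j else 0) ≡ (if c then f i b else 0)
  row true i = sum-select b (f i)
  row false i = sum-replicate-zero n

indicator : Bool → ℕ
indicator b = if b then 1 else 0

∣p∣≡sum : ∀ {n} (p : Subset n) → ∣ p ∣ ≡ sum (indicator ∘ lookup p)
∣p∣≡sum [] = refl
∣p∣≡sum (true ∷ p) = cong suc (∣p∣≡sum p)
∣p∣≡sum (false ∷ p) = ∣p∣≡sum p

∣p∪q∣≤∣p∣+∣q∣ : ∀ {n} (p q : Subset n) → ∣ p ∪ q ∣ ≤ ∣ p ∣ + ∣ q ∣
∣p∪q∣≤∣p∣+∣q∣ [] [] = z≤n
∣p∪q∣≤∣p∣+∣q∣ (true ∷ p) (true ∷ q) = s≤s (≤-trans (∣p∪q∣≤∣p∣+∣q∣ p q) (+-monoʳ-≤ ∣ p ∣ (n≤1+n ∣ q ∣)))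
∣p∪q∣≤∣p∣+∣q∣ (true ∷ p) (false ∷ q) = s≤s (∣p∪q∣≤∣p∣+∣q∣ p q)
∣p∪q∣≤∣p∣+∣q∣ (false ∷ p) (true ∷ q) = ≤-trans (s≤s (∣p∪q∣≤∣p∣+∣q∣ p q)) (≤-reflexive (sym (+-suc ∣ p ∣ ∣ q ∣)))
∣p∪q∣≤∣p∣+∣q∣ (false ∷ p) (false ∷ q) = ∣p∪q∣≤∣p∣+∣q∣ p q

x∉p-x : ∀ {n} (p : Subset n) x → ¬ (x ∈ p - x)
x∉p-x (_ ∷ p) (suc x) (there x∈p-x) = x∉p-x p x x∈p-x

∈-tabulate⁺ : ∀ {n} {f : Fin n → Bool} {x} → f x ≡ true → x ∈ tabulate f
∈-tabulate⁺ {f = f} {x} fx = lookup⇒[]= x (tabulate f) (trans (lookup∘tabulate f x) fx)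

∈-tabulate⁻ : ∀ {n} {f : Fin n → Bool} {x} → x ∈ tabulate f → f x ≡ true
∈-tabulate⁻ {f = f} {x} x∈ = trans (sym (lookup∘tabulate f x)) ([]=⇒lookup x∈)

singletonIf : ∀ {n} → Bool → Fin n → Subset n
singletonIf b x = if b then ⁅ x ⁆ else ∅

∈-singletonIf⁻ : ∀ {n} b {x y : Fin n} → y ∈ singletonIf b x → b ≡ true × y ≡ x
∈-singletonIf⁻ true {x} y∈ = refl , x∈⁅y⁆⇒x≡y x y∈
∈-singletonIf⁻ false y∈ = contradiction y∈ ∉⊥

∈-singletonIf⁺ : ∀ {n} {b} {x : Fin n} → b ≡ true → x ∈ singletonIf b x
∈-singletonIf⁺ {x = x} refl = x∈⁅x⁆ x

∣singletonIf∣ : ∀ {n} b (x : Fin n) → ∣ singletonIf b x ∣ ≡ indicator b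
∣singletonIf∣ true x = ∣⁅x⁆∣≡1 x
∣singletonIf∣ {n} false x = ∣⊥∣≡0 n

preimage : ∀ {m n} → (Fin m → Fin n) → Subset n → Subset m
preimage φ T = tabulate (lookup T ∘ φ)

∈-preimage⁺ : ∀ {m n} {φ : Fin m → Fin n} {T i} → φ i ∈ T → i ∈ preimage φ T
∈-preimage⁺ φi∈T = ∈-tabulate⁺ ([]=⇒lookup φi∈T)

∣preimage∣≡sum : ∀ {m n} (φ : Fin m → Fin n) (T : Subset n) → ∣ preimage φ T ∣ ≡ sum (indicator ∘ lookup T ∘ φ)
∣preimage∣≡sum φ T = trans (∣p∣≡sum (preimage φ T)) (sum-cong-≗ (λ i → cong indicator (lookup∘tabulate (lookup T ∘ φ) i)))

injective⇒∣preimage∣≤ : ∀ {m n} {φ : Fin m → Fin n} → Injective _≡_ _≡_ φ → ∀ T → ∣ preimage φ T ∣ ≤ ∣ T ∣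
injective⇒∣preimage∣≤ {φ = φ} φ-inj T = begin
  ∣ preimage φ T ∣              ≡⟨ ∣preimage∣≡sum φ T ⟩
  sum (indicator ∘ lookup T ∘ φ) ≤⟨ sum∘injective≤sum (indicator ∘ lookup T) φ φ-inj ⟩
  sum (indicator ∘ lookup T)     ≡⟨ sym (∣p∣≡sum T) ⟩
  ∣ T ∣                          ∎
  where open ≤-Reasoning

image : ∀ {m n} → (Fin m → Fin n) → Subset m → Subset n
image φ E = tabulate (λ y → does (any? (λ i → (i ∈? E) ×-dec (φ i ≟ y))))

∈-image⁺ : ∀ {m n} {φ : Fin m → Fin n} {E i} → i ∈ E → φ i ∈ image φ E
∈-image⁺ {φ = φ} {E} {i} i∈E = ∈-tabulate⁺ (dec-true (any? _) (i , i∈E , refl))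

∈-image⁻ : ∀ {m n} {φ : Fin m → Fin n} {E y} → y ∈ image φ E → ∃[ i ] (i ∈ E × φ i ≡ y)
∈-image⁻ {φ = φ} {E} {y} y∈ with any? (λ i → (i ∈? E) ×-dec (φ i ≟ y)) | ∈-tabulate⁻ y∈
... | yes found | _ = found

Reach-source : ∀ {n} {A : Fin n → Fin n → ℕ} {P u v} → Reach A P u v → u ∈ P
Reach-source (here u∈P) = u∈P
Reach-source (step u∈P _ _) = u∈P

Reach-trans : ∀ {n} {A : Fin n → Fin n → ℕ} {P u w v} → Reach A P u w → Reach A P w v → Reach A P u v
Reach-trans (here _) r = r
Reach-trans (step u∈P a r₁) r = step u∈P a (Reach-trans r₁ r)

Reach-map : ∀ {m n} {A : Fin m → Fin m → ℕ} {B : Fin n → Fin n → ℕ} {P : Subset m} {Q : Subset n}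
  (f : Fin m → Fin n) → (∀ {u} → u ∈ P → f u ∈ Q) →
  (∀ {u w} → u ∈ P → w ∈ P → 0 < A u w → Reach B Q (f u) (f w)) →
  ∀ {u v} → Reach A P u v → Reach B Q (f u) (f v)
Reach-map f f∈ edge (here u∈P) = here (f∈ u∈P)
Reach-map f f∈ edge (step u∈P a r) = Reach-trans (edge u∈P (Reach-source r) a) (Reach-map f f∈ edge r)

Reach-mono : ∀ {n} {A : Fin n → Fin n → ℕ} {P Q : Subset n} → P ⊆ Q → ∀ {u v} → Reach A P u v → Reach A Q u v
Reach-mono P⊆Q = Reach-map id P⊆Q (λ u∈P w∈P a → step (P⊆Q u∈P) a (here (P⊆Q w∈P)))

Reach-avoid : ∀ {n} {A : Fin n → Fin n → ℕ} {P} (x : Fin n) {u v} → Reach A P u v → v ≢ x →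
  Reach A (P - x) u v ⊎ ∃[ w ] (0 < A x w × Reach A (P - x) w v)
Reach-avoid x (here v∈P) v≢x = inj₁ (here (x∈p∧x≢y⇒x∈p-y v∈P v≢x))
Reach-avoid x {u} (step {w = w} u∈P a r) v≢x with Reach-avoid x r v≢x
... | inj₂ restart = inj₂ restart
... | inj₁ r′ with u ≟ x
...   | yes refl = inj₂ (w , a , r′)
...   | no u≢x = inj₁ (step (x∈p∧x≢y⇒x∈p-y u∈P u≢x) a r′)

Reach-firstStep : ∀ {n} {A : Fin n → Fin n → ℕ} {P u v} → Reach A P u v → u ≢ v →
  ∃[ w ] (0 < A u w × Reach A (P - u) w v)
Reach-firstStep {u = u} r u≢v with Reach-avoid u r (u≢v ∘ sym)
... | inj₁ r′ = contradiction (Reach-source r′) (x∉p-x _ u)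
... | inj₂ restart = restart

reach? : ∀ {n} (A : Fin n → Fin n → ℕ) (P : Subset n) u v → Dec (Reach A P u v)
reach? A P = bounded (suc ∣ P ∣) P ≤-refl
  where
  bounded : ∀ k P → ∣ P ∣ < k → ∀ u v → Dec (Reach A P u v)
  bounded (suc k) P ∣P∣<1+k u v with u ∈? P | u ≟ v
  ... | no u∉P | _ = no (u∉P ∘ Reach-source)
  ... | yes u∈P | yes refl = yes (here u∈P)
  ... | yes u∈P | no u≢v =
    map′ (λ (w , a , r) → step u∈P a (Reach-mono (p─q⊆p P _) r)) (λ r → Reach-firstStep r u≢v)
         (any? (λ w → (0 <? A u w) ×-dec bounded k (P - u) ∣P-u∣<k w v))
    where
    ∣P-u∣<k : ∣ P - u ∣ < k
    ∣P-u∣<k = <-≤-trans (x∈p⇒∣p-x∣<∣p∣ u∈P) (≤-pred ∣P∣<1+k)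

-- Colourings and their boundaries

crossing : ∀ {n} → (Fin n → Bool) → (Fin n → Fin n → ℕ) → Fin n → Fin n → ℕ
crossing R A u v = if R u xor R v then A u v else 0

crossing-≤ : ∀ {n} R (A : Fin n → Fin n → ℕ) u v → crossing R A u v ≤ A u v
crossing-≤ R A u v with R u xor R v
... | true = ≤-refl
... | false = z≤n

crossing-mono : ∀ {n} R {A B : Fin n → Fin n → ℕ} u v → A u v ≤ B u v → crossing R A u v ≤ crossing R B u v
crossing-mono R u v A≤B with R u xor R v
... | true = A≤B
... | false = z≤n

crossing-+ : ∀ {n} R (A B : Fin n → Fin n → ℕ) u v →
  crossing R (λ u v → A u v + B u v) u v ≡ crossing R A u v + crossing R B u v
crossing-+ R A B u v with R u xor R v
... | true = refl
... | false = refl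

crossing-sym : ∀ {n} R {A : Fin n → Fin n → ℕ} → (∀ u v → A u v ≡ A v u) → ∀ u v → crossing R A u v ≡ crossing R A v u
crossing-sym R {A} A-sym u v rewrite xor-comm (R u) (R v) = cong (λ m → if R v xor R u then m else 0) (A-sym u v)

crossing-monochromatic : ∀ {n} R (A : Fin n → Fin n → ℕ) {u v} → R u ≡ R v → crossing R A u v ≡ 0
crossing-monochromatic R A {u} {v} Ru≡Rv rewrite Ru≡Rv | xor-same (R v) = refl

boundary : ∀ {n} (G : Graph n) → (Fin n → Bool) → EdgeSet G
boundary G R = record
  { cnt = crossing R (adj G)
  ; cnt-sym = crossing-sym R (adj-sym G)
  ; cnt-≤ = crossing-≤ R (adj G)
  }

monochromatic-walk-survives : ∀ {n} (G : Graph n) R b {E} → (∀ {u} → u ∈ E → R u ≡ b) →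
  ∀ {u v} → Reach (adj G) E u v → Reach (deleteEdges G (boundary G R)) full u v
monochromatic-walk-survives G R b R≡b = Reach-map id (λ _ → ∈⊤) λ u∈E w∈E a →
  step ∈⊤ (subst (λ c → 0 < adj G _ _ ∸ c) (sym (crossing-monochromatic R (adj G) (trans (R≡b u∈E) (sym (R≡b w∈E))))) a) (here ∈⊤)

colour-constant-off-boundary : ∀ {n} (G : Graph n) R {u v} → Reach (deleteEdges G (boundary G R)) full u v → R u ≡ R v
colour-constant-off-boundary G R (here _) = refl
colour-constant-off-boundary G R (step {u} {w} _ a r) = trans (uncut-edge (R u) (R w) a) (colour-constant-off-boundary G R r)
  where
  uncut-edge : ∀ a b {m} → 0 < m ∸ (if a xor b then m else 0) → a ≡ b
  uncut-edge false false _ = refl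
  uncut-edge true true _ = refl
  uncut-edge false true {m} p = contradiction (subst (0 <_) (n∸n≡0 m) p) (λ ())
  uncut-edge true false {m} p = contradiction (subst (0 <_) (n∸n≡0 m) p) (λ ())

record Separation {n} {G : Graph n} (S : Scramble G) : Set where
  field
    colour : Fin n → Bool
    egg₁ egg₂ : Subset n
    egg₁∈S : egg₁ ∈ₗ eggs S
    egg₂∈S : egg₂ ∈ₗ eggs S
    colour-egg₁ : ∀ {u} → u ∈ egg₁ → colour u ≡ true
    colour-egg₂ : ∀ {u} → u ∈ egg₂ → colour u ≡ false

separation⇒eggCut : ∀ {n} {G : Graph n} {S : Scramble G} (σ : Separation S) → IsEggCut S (boundary G (Separation.colour σ))
separation⇒eggCut {G = G} {S} σ =
  egg₁ , egg₂ , egg₁∈S , egg₂∈S , connected egg₁∈S colour-egg₁ , connected egg₂∈S colour-egg₂ ,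
  λ u v u∈ v∈ r → contradiction (trans (sym (colour-egg₁ u∈)) (trans (colour-constant-off-boundary G colour r) (colour-egg₂ v∈))) (λ ())
  where
  open Separation σ
  connected : ∀ {E b} → E ∈ₗ eggs S → (∀ {u} → u ∈ E → colour u ≡ b) →
    ∀ u v → u ∈ E → v ∈ E → Reach (deleteEdges G (boundary G colour)) full u v
  connected E∈S E-b u v u∈ v∈ = monochromatic-walk-survives G colour _ E-b (proj₂ (areEggs S _ E∈S) u v u∈ v∈)

crossing≤cnt : ∀ {n} {G : Graph n} (C : EdgeSet G) (R : Fin n → Bool) →
  (∀ u v → R u ≡ true → R v ≡ false → adj G u v ≤ cnt C u v) → ∀ u v → crossing R (adj G) u v ≤ cnt C u v
crossing≤cnt {G = G} C R closed u v with R u in Ru | R v in Rv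
... | true | true = z≤n
... | false | false = z≤n
... | true | false = closed u v Ru Rv
... | false | true = subst₂ _≤_ (adj-sym G v u) (cnt-sym C v u) (closed v u Rv Ru)

-- Colour by reachability from an egg after deleting the cut.
eggCut⇒separation : ∀ {n} {G : Graph n} {S : Scramble G} (C : EdgeSet G) → IsEggCut S C →
  Σ (Separation S) λ σ → ∀ u v → crossing (Separation.colour σ) (adj G) u v ≤ cnt C u v
eggCut⇒separation {n} {G} {S} C (E₁ , E₂ , E₁∈S , E₂∈S , E₁-connected , _ , E₁↛E₂) = σ , crossing≤cnt C R closed
  where
  s : Fin n
  s = proj₁ (proj₁ (areEggs S E₁ E₁∈S))
  s∈E₁ : s ∈ E₁
  s∈E₁ = proj₂ (proj₁ (areEggs S E₁ E₁∈S))
  reachable? : ∀ v → Dec (Reach (deleteEdges G C) full s v)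
  reachable? = reach? (deleteEdges G C) full s
  R : Fin n → Bool
  R v = does (reachable? v)
  σ : Separation S
  σ = record
    { colour = R ; egg₁ = E₁ ; egg₂ = E₂ ; egg₁∈S = E₁∈S ; egg₂∈S = E₂∈S
    ; colour-egg₁ = λ u∈ → dec-true (reachable? _) (E₁-connected s _ s∈E₁ u∈)
    ; colour-egg₂ = λ v∈ → dec-false (reachable? _) (E₁↛E₂ s _ s∈E₁ v∈)
    }
  reached : ∀ u → R u ≡ true → Reach (deleteEdges G C) full s u
  reached u Ru with reachable? u | Ru
  ... | yes r | _ = r
  closed : ∀ u v → R u ≡ true → R v ≡ false → adj G u v ≤ cnt C u v
  closed u v Ru Rv = ≮⇒≥ λ cnt<adj →
    contradiction (trans (sym Rv) (dec-true (reachable? v)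
      (Reach-trans (reached u Ru) (step ∈⊤ (m<n⇒0<n∸m cnt<adj) (here ∈⊤))))) (λ ())

-- Edge counts as halves of ordered pair sums

upper : ∀ {n} → (Fin n → Fin n → ℕ) → Fin n → Fin n → ℕ
upper f u v = if toℕ u <ᵇ toℕ v then f u v else 0

upper+lower : ∀ {n} (f : Fin n → Fin n → ℕ) → (∀ u v → f u v ≡ f v u) → (∀ u → f u u ≡ 0) →
  ∀ u v → f u v ≡ upper f u v + upper f v u
upper+lower f f-sym f-diag u v
  with toℕ u <ᵇ toℕ v | <ᵇ-reflects-< (toℕ u) (toℕ v) | toℕ v <ᵇ toℕ u | <ᵇ-reflects-< (toℕ v) (toℕ u)
... | true | ofʸ u<v | true | ofʸ v<u = contradiction v<u (<⇒≯ u<v)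
... | true | _ | false | _ = sym (+-identityʳ _)
... | false | _ | true | _ = f-sym u v
... | false | ofⁿ u≮v | false | ofⁿ v≮u with toℕ-injective (≤-antisym (≮⇒≥ v≮u) (≮⇒≥ u≮v))
...   | refl = f-diag u

edgeCount≡pairSum-upper : ∀ {n} {G : Graph n} (C : EdgeSet G) → edgeCount C ≡ pairSum (upper (cnt C))
edgeCount≡pairSum-upper C =
  trans (ΣFin≡sum (λ u → ΣFin (upper (cnt C) u))) (sum-cong-≗ (λ u → ΣFin≡sum (upper (cnt C) u)))

edgeCount-double : ∀ {n} {G : Graph n} (C : EdgeSet G) → 2 * edgeCount C ≡ pairSum (cnt C)
edgeCount-double {G = G} C = begin
  2 * edgeCount C                           ≡⟨ cong (2 *_) (edgeCount≡pairSum-upper C) ⟩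
  2 * pairSum U                             ≡⟨ cong (pairSum U +_) (trans (+-identityʳ _) (sym (pairSum-transpose U))) ⟩
  pairSum U + pairSum (λ u v → U v u)       ≡⟨ sym (pairSum-+ U (λ u v → U v u)) ⟩
  pairSum (λ u v → U u v + U v u)           ≡⟨ sum-cong-≗ (λ u → sum-cong-≗ (λ v → sym (upper+lower (cnt C) (cnt-sym C) cnt-diag u v))) ⟩
  pairSum (cnt C)                           ∎
  where
  open ≡-Reasoning
  U = upper (cnt C)
  cnt-diag : ∀ u → cnt C u u ≡ 0
  cnt-diag u = n≤0⇒n≡0 (subst (cnt C u u ≤_) (loopless G u) (cnt-≤ C u u))

edgeCount-≤ : ∀ {m n} {H : Graph m} {G : Graph n} (C : EdgeSet H) (D : EdgeSet G) →
  pairSum (cnt C) ≤ pairSum (cnt D) → edgeCount C ≤ edgeCount D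
edgeCount-≤ C D le = *-cancelˡ-≤ 2 (subst₂ _≤_ (sym (edgeCount-double C)) (sym (edgeCount-double D)) le)

-- Transferring scrambles from H to G

record Transfer {m n} (H : Graph m) (G : Graph n) : Set where
  field
    vertex : Fin m → Fin n
    egg : Subset m → Subset n
    egg-isEgg : ∀ {E} → IsEgg H E → IsEgg G (egg E)
    vertex∈egg : ∀ {E u} → u ∈ E → vertex u ∈ egg E
    pullback : Subset n → Subset m
    ∣pullback∣≤ : ∀ T → ∣ pullback T ∣ ≤ ∣ T ∣
    pullback-meets : ∀ {T E y} → y ∈ T → y ∈ egg E → ∃[ u ] (u ∈ pullback T × u ∈ E)
    pairSum-crossing-≤ : ∀ R → pairSum (crossing (R ∘ vertex) (adj H)) ≤ pairSum (crossing R (adj G))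

transfer⇒sn≤ : ∀ {m n} {H : Graph m} {G : Graph n} → Transfer H G → H sn≤ G
transfer⇒sn≤ {H = H} {G} τ k (S , h≥k , e≥k) = S′ , h′≥k , e′≥k
  where
  open Transfer τ
  S′ : Scramble G
  S′ = record
    { eggs = List.map egg (eggs S)
    ; areEggs = λ E′ E′∈S′ → let (E , E∈S , E′≡egg) = ∈-map⁻ egg E′∈S′ in
        subst (IsEgg G) (sym E′≡egg) (egg-isEgg (areEggs S E E∈S))
    }
  h′≥k : HittingNumberAtLeast S′ k
  h′≥k T T-hits = ≤-trans (h≥k (pullback T) pullback-hits) (∣pullback∣≤ T)
    where
    pullback-hits : Hits S (pullback T)
    pullback-hits E E∈S = let (y , y∈T , y∈egg) = T-hits (egg E) (∈-map⁺ egg E∈S) in pullback-meets y∈T y∈egg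
  egg⁻¹ : ∀ {E′} → E′ ∈ₗ eggs S′ → ∃[ E ] (E ∈ₗ eggs S × (∀ {u} → u ∈ E → vertex u ∈ E′))
  egg⁻¹ E′∈S′ = let (E , E∈S , E′≡egg) = ∈-map⁻ egg E′∈S′ in
    E , E∈S , λ u∈E → subst (_ ∈_) (sym E′≡egg) (vertex∈egg u∈E)
  pullbackSeparation : Separation S′ → Separation S
  pullbackSeparation σ′ = record
    { colour = colour ∘ vertex
    ; egg₁ = proj₁ E₁ ; egg₂ = proj₁ E₂ ; egg₁∈S = proj₁ (proj₂ E₁) ; egg₂∈S = proj₁ (proj₂ E₂)
    ; colour-egg₁ = colour-egg₁ ∘ proj₂ (proj₂ E₁)
    ; colour-egg₂ = colour-egg₂ ∘ proj₂ (proj₂ E₂)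
    }
    where
    open Separation σ′
    E₁ = egg⁻¹ egg₁∈S
    E₂ = egg⁻¹ egg₂∈S
  e′≥k : EggCutNumberAtLeast S′ k
  e′≥k C C-cut with eggCut⇒separation C C-cut
  ... | σ′ , crossing≤C = ≤-trans (e≥k cut (separation⇒eggCut (pullbackSeparation σ′))) (edgeCount-≤ cut C pairSum≤)
    where
    R = Separation.colour σ′
    cut = boundary H (R ∘ vertex)
    pairSum≤ : pairSum (cnt cut) ≤ pairSum (cnt C)
    pairSum≤ = ≤-trans (pairSum-crossing-≤ R) (pairSum-mono-≤ crossing≤C)

embeddingTransfer : ∀ {m n} {H : Graph m} {G : Graph n} (φ : Fin m → Fin n) → Injective _≡_ _≡_ φ →
  (∀ i j → adj H i j ≤ adj G (φ i) (φ j)) → Transfer H G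
embeddingTransfer {H = H} {G} φ φ-inj H≤G = record
  { vertex = φ
  ; egg = image φ
  ; egg-isEgg = image-isEgg
  ; vertex∈egg = ∈-image⁺
  ; pullback = preimage φ
  ; ∣pullback∣≤ = injective⇒∣preimage∣≤ φ-inj
  ; pullback-meets = meets
  ; pairSum-crossing-≤ = λ R →
      ≤-trans (pairSum-mono-≤ (λ i j → crossing-mono (R ∘ φ) {adj H} {λ i j → adj G (φ i) (φ j)} i j (H≤G i j)))
              (pairSum∘injective≤pairSum (crossing R (adj G)) φ φ-inj)
  }
  where
  image-isEgg : ∀ {E} → IsEgg H E → IsEgg G (image φ E)
  image-isEgg {E} ((u , u∈E) , E-connected) = (φ u , ∈-image⁺ u∈E) , connected
    where
    connected : ∀ y z → y ∈ image φ E → z ∈ image φ E → Reach (adj G) (image φ E) y z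
    connected y z y∈ z∈ with ∈-image⁻ {φ = φ} y∈ | ∈-image⁻ {φ = φ} z∈
    ... | i , i∈E , refl | j , j∈E , refl =
      Reach-map φ ∈-image⁺ (λ a∈ b∈ a~b → step (∈-image⁺ a∈) (<-≤-trans a~b (H≤G _ _)) (here (∈-image⁺ b∈)))
        (E-connected i j i∈E j∈E)
  meets : ∀ {T E y} → y ∈ T → y ∈ image φ E → ∃[ u ] (u ∈ preimage φ T × u ∈ E)
  meets y∈T y∈ with ∈-image⁻ {φ = φ} y∈
  ... | u , u∈E , refl = u , ∈-preimage⁺ y∈T , u∈E

-- Multi-smoothing

pairIndicator : ∀ {n} → Fin n → Fin n → Fin n → Fin n → Bool
pairIndicator v w i j = (does (i ≟ v) ∧ does (j ≟ w)) ∨ (does (i ≟ w) ∧ does (j ≟ v))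

pairIndicator-true : ∀ {n} (v w i j : Fin n) → T (pairIndicator v w i j) → (i ≡ v × j ≡ w) ⊎ (i ≡ w × j ≡ v)
pairIndicator-true v w i j t with i ≟ v | j ≟ w | i ≟ w | j ≟ v
... | yes i≡v | yes j≡w | _ | _ = inj₁ (i≡v , j≡w)
... | _ | _ | yes i≡w | yes j≡v = inj₂ (i≡w , j≡v)
... | yes _ | no _ | yes _ | no _ = ⊥-elim t
... | yes _ | no _ | no _ | _ = ⊥-elim t
... | no _ | _ | yes _ | no _ = ⊥-elim t
... | no _ | _ | no _ | _ = ⊥-elim t

if-positive : ∀ b {μ} → 0 < (if b then μ else 0) → T b × 0 < μ
if-positive true 0<μ = _ , 0<μ
if-positive false ()

if-∨-split : ∀ a b c (μ : ℕ) →
  (if c then (if a ∨ b then μ else 0) else 0) ≤ (if a then (if c then μ else 0) else 0) + (if b then (if c then μ else 0) else 0)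
if-∨-split a b false μ = z≤n
if-∨-split true b true μ = m≤m+n μ _
if-∨-split false true true μ = ≤-refl
if-∨-split false false true μ = z≤n

-- If v and w get different colours, then the hub x differs from one of them.
separated-neighbours : ∀ a b c {μ M N} → μ ≤ M → μ ≤ N →
  (if a xor b then μ else 0) ≤ (if c xor a then M else 0) ⊔ (if c xor b then N else 0)
separated-neighbours true true c _ _ = z≤n
separated-neighbours false false c _ _ = z≤n
separated-neighbours true false true _ μ≤N = μ≤N
separated-neighbours true false false μ≤M _ = m≤n⇒m≤n⊔o 0 μ≤M
separated-neighbours false true true μ≤M _ = m≤n⇒m≤n⊔o 0 μ≤M
separated-neighbours false true false _ μ≤N = μ≤N

module Smoothing {n} {H : Graph n} {G : Graph (suc n)} (x : Fin (suc n)) (v w : Fin n) (μ : ℕ)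
  (x~v : 0 < adj G x (punchIn x v)) (μ≤v : μ ≤ adj G x (punchIn x v)) (μ≤w : μ ≤ adj G x (punchIn x w))
  (H≤G : ∀ i j → adj H i j ≤ adj G (punchIn x i) (punchIn x j) + (if pairIndicator v w i j then μ else 0))
  where

  p : Fin n → Fin (suc n)
  p = punchIn x

  -- x joins the image of an egg that contains v; the edges x–v keep it connected.
  egg : Subset n → Subset (suc n)
  egg E = image p E ∪ singletonIf (lookup E v) x

  p∈egg : ∀ {E u} → u ∈ E → p u ∈ egg E
  p∈egg u∈E = x∈p∪q⁺ (inj₁ (∈-image⁺ u∈E))

  x∈egg : ∀ {E} → v ∈ E → x ∈ egg E
  x∈egg v∈E = x∈p∪q⁺ (inj₂ (∈-singletonIf⁺ ([]=⇒lookup v∈E)))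

  to-x : ∀ {E u} → v ∈ E → u ∈ E → 0 < adj G x (p u) → Reach (adj G) (egg E) (p u) x
  to-x {u = u} v∈E u∈E x~u = step (p∈egg u∈E) (subst (0 <_) (adj-sym G x (p u)) x~u) (here (x∈egg v∈E))

  from-x : ∀ {E u} → v ∈ E → u ∈ E → 0 < adj G x (p u) → Reach (adj G) (egg E) x (p u)
  from-x v∈E u∈E x~u = step (x∈egg v∈E) x~u (here (p∈egg u∈E))

  edge-path : ∀ {E a b} → a ∈ E → b ∈ E → 0 < adj H a b → Reach (adj G) (egg E) (p a) (p b)
  edge-path {a = a} {b} a∈E b∈E a~b with 0 <? adj G (p a) (p b)
  ... | yes pa~pb = step (p∈egg a∈E) pa~pb (here (p∈egg b∈E))
  ... | no pa≁pb with if-positive (pairIndicator v w a b) added-edge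
    where
    added-edge : 0 < (if pairIndicator v w a b then μ else 0)
    added-edge = <-≤-trans a~b (subst (λ k → adj H a b ≤ k + _) (n≤0⇒n≡0 (≮⇒≥ pa≁pb)) (H≤G a b))
  ... | t , 0<μ with pairIndicator-true v w a b t
  ...   | inj₁ (refl , refl) = Reach-trans (to-x a∈E a∈E x~v) (from-x a∈E b∈E (<-≤-trans 0<μ μ≤w))
  ...   | inj₂ (refl , refl) = Reach-trans (to-x b∈E a∈E (<-≤-trans 0<μ μ≤w)) (from-x b∈E b∈E x~v)

  anchor : ∀ {E y} → y ∈ egg E → ∃[ u ] (u ∈ E × Reach (adj G) (egg E) y (p u) × Reach (adj G) (egg E) (p u) y)
  anchor {E} y∈ with x∈p∪q⁻ (image p E) _ y∈
  ... | inj₁ y∈image with ∈-image⁻ {φ = p} y∈image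
  ...   | u , u∈E , refl = u , u∈E , here y∈ , here y∈
  anchor {E} y∈ | inj₂ y∈x with ∈-singletonIf⁻ (lookup E v) y∈x
  ...   | Ev , refl = v , v∈E , from-x v∈E v∈E x~v , to-x v∈E v∈E x~v
    where
    v∈E : v ∈ E
    v∈E = lookup⇒[]= v E Ev

  egg-isEgg : ∀ {E} → IsEgg H E → IsEgg G (egg E)
  egg-isEgg ((u , u∈E) , E-connected) = (p u , p∈egg u∈E) , λ y z y∈ z∈ →
    let (u₁ , u₁∈E , y→u₁ , _) = anchor y∈
        (u₂ , u₂∈E , _ , u₂→z) = anchor z∈
    in Reach-trans y→u₁ (Reach-trans (Reach-map p p∈egg edge-path (E-connected u₁ u₂ u₁∈E u₂∈E)) u₂→z)

  pullback : Subset (suc n) → Subset n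
  pullback T = preimage p T ∪ singletonIf (lookup T x) v

  ∣pullback∣≤ : ∀ T → ∣ pullback T ∣ ≤ ∣ T ∣
  ∣pullback∣≤ T = begin
    ∣ pullback T ∣                                           ≤⟨ ∣p∪q∣≤∣p∣+∣q∣ (preimage p T) _ ⟩
    ∣ preimage p T ∣ + ∣ singletonIf (lookup T x) v ∣        ≡⟨ cong₂ _+_ (∣preimage∣≡sum p T) (∣singletonIf∣ (lookup T x) v) ⟩
    sum (indicator ∘ lookup T ∘ p) + indicator (lookup T x) ≡⟨ +-comm _ (indicator (lookup T x)) ⟩
    indicator (lookup T x) + sum (indicator ∘ lookup T ∘ p) ≡⟨ sym (sum-remove {i = x} (indicator ∘ lookup T)) ⟩
    sum (indicator ∘ lookup T)                               ≡⟨ sym (∣p∣≡sum T) ⟩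
    ∣ T ∣                                                    ∎
    where open ≤-Reasoning

  pullback-meets : ∀ {T E y} → y ∈ T → y ∈ egg E → ∃[ u ] (u ∈ pullback T × u ∈ E)
  pullback-meets {T} {E} y∈T y∈ with x∈p∪q⁻ (image p E) _ y∈
  ... | inj₁ y∈image with ∈-image⁻ {φ = p} y∈image
  ...   | u , u∈E , refl = u , x∈p∪q⁺ (inj₁ (∈-preimage⁺ y∈T)) , u∈E
  pullback-meets {T} {E} y∈T y∈ | inj₂ y∈x with ∈-singletonIf⁻ (lookup E v) y∈x
  ...   | Ev , refl = v , x∈p∪q⁺ (inj₂ (∈-singletonIf⁺ ([]=⇒lookup y∈T))) , lookup⇒[]= v E Ev

  module _ (R : Fin (suc n) → Bool) where

    g : Fin (suc n) → Fin (suc n) → ℕ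
    g = crossing R (adj G)

    Q : Fin n → Bool
    Q = R ∘ p

    crossing-μ : Fin n → Fin n → ℕ
    crossing-μ = crossing Q (λ _ _ → μ)

    added : Fin n → Fin n → Fin n → Fin n → ℕ
    added a b i j = if does (i ≟ a) ∧ does (j ≟ b) then crossing-μ i j else 0

    crossing-H≤ : ∀ i j → crossing Q (adj H) i j ≤ g (p i) (p j) + (added v w i j + added w v i j)
    crossing-H≤ i j = begin
      crossing Q (adj H) i j
        ≤⟨ crossing-mono Q {adj H} {λ i j → adj G (p i) (p j) + (if pairIndicator v w i j then μ else 0)} i j (H≤G i j) ⟩
      crossing Q (λ i j → adj G (p i) (p j) + (if pairIndicator v w i j then μ else 0)) i j
        ≡⟨ crossing-+ Q (λ i j → adj G (p i) (p j)) (λ i j → if pairIndicator v w i j then μ else 0) i j ⟩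
      g (p i) (p j) + crossing Q (λ i j → if pairIndicator v w i j then μ else 0) i j
        ≤⟨ +-monoʳ-≤ (g (p i) (p j))
             (if-∨-split (does (i ≟ v) ∧ does (j ≟ w)) (does (i ≟ w) ∧ does (j ≟ v)) (Q i xor Q j) μ) ⟩
      g (p i) (p j) + (added v w i j + added w v i j) ∎
      where open ≤-Reasoning

    star : ℕ
    star = sum (λ j → g x (p j))

    crossing-μ≤star : crossing-μ v w ≤ star
    crossing-μ≤star = ≤-trans (separated-neighbours (Q v) (Q w) (R x) μ≤v μ≤w) (⊔-lub (term≤sum _ v) (term≤sum _ w))

    pairSum-g : pairSum g ≡ sum (g x) + (star + pairSum (λ i j → g (p i) (p j)))
    pairSum-g = trans (pairSum-remove x g)
      (cong (λ s → sum (g x) + (s + pairSum (λ i j → g (p i) (p j))))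
            (sum-cong-≗ (λ i → crossing-sym R (adj-sym G) (p i) x)))

    pairSum-crossing-≤ : pairSum (crossing Q (adj H)) ≤ pairSum g
    pairSum-crossing-≤ = begin
      pairSum (crossing Q (adj H))
        ≤⟨ pairSum-mono-≤ crossing-H≤ ⟩
      pairSum (λ i j → g (p i) (p j) + (added v w i j + added w v i j))
        ≡⟨ trans (pairSum-+ (λ i j → g (p i) (p j)) _) (cong (inner +_) (pairSum-+ (added v w) (added w v))) ⟩
      inner + (pairSum (added v w) + pairSum (added w v))
        ≡⟨ cong₂ (λ s t → inner + (s + t)) (pairSum-select v w crossing-μ)
                 (trans (pairSum-select w v crossing-μ) (crossing-sym Q (λ _ _ → refl) w v)) ⟩
      inner + (crossing-μ v w + crossing-μ v w)
        ≡⟨ trans (+-comm inner _) (+-assoc (crossing-μ v w) _ inner) ⟩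
      crossing-μ v w + (crossing-μ v w + inner)
        ≤⟨ +-mono-≤ (≤-trans crossing-μ≤star (sum∘injective≤sum (g x) p (punchIn-injective x _ _)))
                    (+-monoˡ-≤ inner crossing-μ≤star) ⟩
      sum (g x) + (star + inner)
        ≡⟨ sym pairSum-g ⟩
      pairSum g ∎
      where
      open ≤-Reasoning
      inner = pairSum (λ i j → g (p i) (p j))

  smoothingTransfer : Transfer H G
  smoothingTransfer = record
    { vertex = p
    ; egg = egg
    ; egg-isEgg = egg-isEgg
    ; vertex∈egg = p∈egg
    ; pullback = pullback
    ; ∣pullback∣≤ = ∣pullback∣≤
    ; pullback-meets = pullback-meets
    ; pairSum-crossing-≤ = pairSum-crossing-≤
    }

open Smoothing using (smoothingTransfer)

permutation-injective : ∀ {n} (σ : Permutation′ n) → Injective _≡_ _≡_ (σ ⟨$⟩ʳ_)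
permutation-injective σ σi≡σj = trans (sym (inverseˡ σ)) (trans (cong (σ ⟨$⟩ˡ_) σi≡σj) (inverseˡ σ))

proposition4p3 : ∀ {m n} (H : Graph m) (G : Graph n) → H ≼ G → H sn≤ G
proposition4p3 H G (iso σ H≡G) =
  transfer⇒sn≤ (embeddingTransfer (σ ⟨$⟩ʳ_) (permutation-injective σ) (λ i j → ≤-reflexive (H≡G i j)))
proposition4p3 H G (delE H≤G) = transfer⇒sn≤ (embeddingTransfer id id H≤G)
proposition4p3 H G (delV x H≡G-x) =
  transfer⇒sn≤ (embeddingTransfer (punchIn x) (punchIn-injective x _ _) (λ i j → ≤-reflexive (H≡G-x i j)))
proposition4p3 H G (smooth x v w _ x~v _ _ H≡smoothed) =
  transfer⇒sn≤ (smoothingTransfer x v w _ x~v (m⊓n≤m _ _) (m⊓n≤n _ _) (λ i j → ≤-reflexive (H≡smoothed i j)))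
proposition4p3 H G (trans≼ {H = K} H≼K K≼G) k = proposition4p3 K G K≼G k ∘ proposition4p3 H K H≼K k
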